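{- Let $T$ be a tournament. Then $\check T$ is acyclically indecomposable and $T$ is the lexicographical sum of its acyclic components indexed by $\check T$.
   Context: A tournament is a set with an irreflexive, antisymmetric, complete binary relation; acyclic means no $3$-cycle. A subset $B$ of vertices is autonomous if for all $x,x'\in B$ and $y\notin B$, $(x,y)$ is an edge iff $(x',y)$ is an edge. A tournament is acyclically indecomposable if no autonomous subset inducing an acyclic tournament has more than one element. The acyclic component $Ac(T)(x)$ of $x\in V(T)$ is the union of all acyclic autonomous subsets containing $x$; $Ac(T)$ is the set of acyclic components. $\check T$ is the tournament with vertex set $Ac(T)$ and edge set $\{(Ac(T)(x),Ac(T)(y)) : Ac(T)(x)\ne Ac(T)(y),\ (x,y)\in E(T)\}$. Lexicographical sum $\sum_{i\in D}T_i$: vertex set the disjoint union of the $V(T_i)$, with $(x,i)\to(y,j)$ iff ($i=j$ and $x\to y$ in $T_i$) or $i\to j$ in $D$ (here each component is taken with the tournament induced on it by $T$). -}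

module Defs where

open import Level using (Level; 0ℓ; _⊔_) renaming (suc to lsuc)
open import Relation.Unary using (Pred; _≐_)
open import Data.Product using (_×_; ∃; ∃₂; _,_)
open import Data.Sum using (_⊎_)
open import Data.Empty using (⊥)
open import Relation.Nullary using (¬_)
open import Relation.Binary.PropositionalEquality using (_≡_; _≢_)
open import Function.Bundles using (_⇔_)

record Tournament : Set₁ where
  field
    V        : Set
    E        : V → V → Set
    irrefl   : ∀ x → ¬ E x x
    antisym  : ∀ x y → E x y → E y x → x ≡ y
    complete : ∀ x y → x ≢ y → E x y ⊎ E y x

module _ {a e : Level} {V : Set a} (E : V → V → Set e) where

  Acyclic : ∀ {ℓ} → Pred V ℓ → Set (a ⊔ e ⊔ ℓ)
  Acyclic B = ∀ x y z → B x → B y → B z → ¬ (E x y × E y z × E z x)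

  Autonomous : ∀ {ℓ} → Pred V ℓ → Set (a ⊔ e ⊔ ℓ)
  Autonomous B = ∀ x x' y → B x → B x' → ¬ B y → (E x y ⇔ E x' y)

-- Acyclic indecomposability of (V/≈, E): every autonomous subset
-- (a ≈-closed predicate, i.e. a subset of the quotient) inducing an
-- acyclic tournament has at most one element (up to ≈).
AcyclicallyIndecomposable : ∀ {a e r} ℓ {V : Set a} (_≈_ : V → V → Set r)
  (E : V → V → Set e) → Set (a ⊔ e ⊔ r ⊔ lsuc ℓ)
AcyclicallyIndecomposable ℓ {V} _≈_ E =
  (B : Pred V ℓ) → (∀ x y → x ≈ y → B x → B y) →
  Autonomous E B → Acyclic E B →
  ∀ x y → B x → B y → x ≈ y

module _ (T : Tournament) where
  open Tournament T

  Ac : V → Pred V (lsuc 0ℓ)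
  Ac x y = ∃ λ (B : Pred V 0ℓ) → Autonomous E B × Acyclic E B × B x × B y

  -- Ť: vertices are the components Ac(T)(a), represented by a ∈ V,
  -- with a and b representing the same vertex iff Ac(T)(a) = Ac(T)(b).
  _≈̌_ : V → V → Set (lsuc 0ℓ)
  a ≈̌ b = Ac a ≐ Ac b

  Ě : V → V → Set (lsuc 0ℓ)
  Ě a b = ¬ (a ≈̌ b) × ∃₂ λ x y → (x ≈̌ a) × (y ≈̌ b) × E x y

  -- T is the lexicographical sum Σ_{i ∈ D} T[C i], where the index
  -- tournament D has vertex type I up to _≈I_ with edge relation D, and
  -- C i ⊆ V(T) is the vertex set of the summand indexed by i (each summand
  -- carrying the tournament induced by T):
  --   * V(T) is the disjoint union of the C i,
  --   * for x ∈ C i, y ∈ C j: (x,y) ∈ E(T) iff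
  --       (i = j and (x,y) ∈ E(T)) or (i ≠ j and (i,j) ∈ D).
  IsLexSum : ∀ {i r d ℓ} {I : Set i} (_≈I_ : I → I → Set r)
    (D : I → I → Set d) (C : I → Pred V ℓ) → Set (i ⊔ r ⊔ d ⊔ ℓ)
  IsLexSum {I = I} _≈I_ D C =
    (∀ x → ∃ λ i → C i x) ×
    (∀ i j x → C i x → C j x → i ≈I j) ×
    (∀ i j x y → C i x → C j y →
       (E x y ⇔ ((i ≈I j × E x y) ⊎ (¬ (i ≈I j) × D i j))))

-- Two acyclic autonomous sets A, B sharing a vertex x have an acyclic
-- autonomous union: a 3-cycle p → q → r → p in A ∪ B lying in neither set
-- has, up to swapping A and B and rotating, p ∈ B and q ∈ A ∖ B; then
-- autonomy of B either contradicts q → r (if r ∈ B) or turns the cycle into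
-- the 3-cycle x → q → r → x inside A. Hence "lying in a common acyclic autonomous
-- set" is an equivalence relation whose classes Ac(x) are themselves acyclic
-- and autonomous. Autonomy of the classes makes all edges between two classes
-- point the same way, which is the lexicographic-sum decomposition; and an
-- acyclic autonomous set of Ť pulls back to an acyclic autonomous set of T,
-- so it lies inside a single class.
module Submission where

open import Defs
open import Level using (0ℓ; lift; lower) renaming (suc to lsuc)
open import Data.Product using (_×_; _,_)
open import Data.Sum using (_⊎_; inj₁; inj₂; swap)
open import Data.Empty using (⊥-elim)
open import Relation.Nullary using (¬_; Dec; yes; no)
open import Relation.Nullary.Decidable using (True; toWitness; fromWitness; map′)
open import Relation.Unary using (Pred; _∪_)
open import Relation.Binary.PropositionalEquality using (_≡_; refl; subst)
open import Function.Bundles using (_⇔_; mk⇔; Equivalence)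
open import Axiom.ExcludedMiddle using (ExcludedMiddle)

module _ (T : Tournament) where
  open Tournament T

  E-asym : ∀ {u v} → E u v → ¬ E v u
  E-asym {u} {v} uv vu with antisym u v uv vu
  ... | refl = irrefl u uv

  Cycle : V → V → V → Set
  Cycle a b c = E a b × E b c × E c a

  Cycle-rotate : ∀ {a b c} → Cycle a b c → Cycle b c a
  Cycle-rotate (ab , bc , ca) = bc , ca , ab

  module _ {ℓ} {B : Pred V ℓ} (autB : Autonomous E B) where

    autonomous-out : ∀ {u u' z} → B u → B u' → ¬ B z → E u z → E u' z
    autonomous-out {u} {u'} {z} bu bu' nz = Equivalence.to (autB u u' z bu bu' nz)

    autonomous-in : ∀ {u u' z} → B u → B u' → ¬ B z → E z u → E z u'
    autonomous-in {u} {u'} {z} bu bu' nz zu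
      with complete u' z (λ u'≡z → nz (subst B u'≡z bu'))
    ... | inj₂ zu' = zu'
    ... | inj₁ u'z = ⊥-elim (E-asym zu (autonomous-out bu' bu nz u'z))

  ∪-autonomous : ∀ {ℓ₁ ℓ₂} {A : Pred V ℓ₁} {B : Pred V ℓ₂} {x} →
                 Autonomous E A → Autonomous E B → A x → B x → Autonomous E (A ∪ B)
  ∪-autonomous {A = A} {B} {x} autA autB xA xB u u' z u∈ u'∈ nz =
    mk⇔ (λ uz → from-x u'∈ (to-x u∈ uz)) (λ u'z → from-x u∈ (to-x u'∈ u'z))
    where
    nzA : ¬ A z
    nzA zA = nz (inj₁ zA)
    nzB : ¬ B z
    nzB zB = nz (inj₂ zB)
    to-x : ∀ {v} → (A ∪ B) v → E v z → E x z
    to-x (inj₁ vA) = autonomous-out autA vA xA nzA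
    to-x (inj₂ vB) = autonomous-out autB vB xB nzB
    from-x : ∀ {v} → (A ∪ B) v → E x z → E v z
    from-x (inj₁ vA) = autonomous-out autA xA vA nzA
    from-x (inj₂ vB) = autonomous-out autB xB vB nzB

  no-crossing-cycle : ∀ {ℓ₁ ℓ₂} {A : Pred V ℓ₁} {B : Pred V ℓ₂} {x} →
                      Autonomous E B → Acyclic E A → A x → B x → (∀ r → Dec (B r)) →
                      ∀ {p q r} → B p → ¬ B q → A q → (A ∪ B) r → ¬ Cycle p q r
  no-crossing-cycle {x = x} autB acA xA xB B? {q = q} {r = r} pB nqB qA r∈ (pq , qr , rp)
    with B? r | r∈
  ... | yes rB | _ = E-asym qr (autonomous-out autB pB rB nqB pq)
  ... | no nrB | inj₂ rB = nrB rB
  ... | no nrB | inj₁ rA =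
    acA x q r xA qA rA (autonomous-out autB pB xB nqB pq , qr , autonomous-in autB pB xB nrB rp)

  singleton-autonomous : ∀ x → Autonomous E (_≡ x)
  singleton-autonomous x u u' z refl refl _ = mk⇔ (λ uz → uz) (λ uz → uz)

  singleton-acyclic : ∀ x → Acyclic E (_≡ x)
  singleton-acyclic x a b c refl refl refl (ab , _) = irrefl x ab

module _ (em : ExcludedMiddle (lsuc 0ℓ)) (T : Tournament) where
  open Tournament T

  dec₀ : (P : Set) → Dec P
  dec₀ P = map′ lower lift em

  module _ {A B : Pred V 0ℓ} {x} (autA : Autonomous E A) (autB : Autonomous E B)
           (acA : Acyclic E A) (acB : Acyclic E B) (xA : A x) (xB : B x) where

    ∪-cycle-outside-A : ∀ {p q r} → ¬ A p → (A ∪ B) p → (A ∪ B) q → (A ∪ B) r →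
                        ¬ Cycle T p q r
    ∪-cycle-outside-A npA (inj₁ pA) _ _ _ = npA pA
    ∪-cycle-outside-A {p} {q} {r} npA (inj₂ pB) q∈ r∈ cy
      with dec₀ (B q) | dec₀ (B r) | q∈ | r∈
    ... | no nqB | _      | inj₁ qA | _ =
      no-crossing-cycle T autB acA xA xB (λ v → dec₀ (B v)) pB nqB qA r∈ cy
    ... | no nqB | _      | inj₂ qB | _ = nqB qB
    ... | yes _  | no nrB | _ | inj₁ rA =
      no-crossing-cycle T autA acB xB xA (λ v → dec₀ (A v)) rA npA pB (swap q∈)
        (Cycle-rotate T (Cycle-rotate T cy))
    ... | yes _  | no nrB | _ | inj₂ rB = nrB rB
    ... | yes qB | yes rB | _ | _ = acB p q r pB qB rB cy

    ∪-acyclic : Acyclic E (A ∪ B)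
    ∪-acyclic a b c a∈ b∈ c∈ cy with dec₀ (A a) | dec₀ (A b) | dec₀ (A c)
    ... | yes aA | yes bA | yes cA = acA a b c aA bA cA cy
    ... | no naA | _      | _      = ∪-cycle-outside-A naA a∈ b∈ c∈ cy
    ... | yes _  | no nbA | _      = ∪-cycle-outside-A nbA b∈ c∈ a∈ (Cycle-rotate T cy)
    ... | yes _  | yes _  | no ncA =
      ∪-cycle-outside-A ncA c∈ a∈ b∈ (Cycle-rotate T (Cycle-rotate T cy))

  Ac-refl : ∀ x → Ac T x x
  Ac-refl x = (_≡ x) , singleton-autonomous T x , singleton-acyclic T x , refl , refl

  Ac-sym : ∀ {x y} → Ac T x y → Ac T y x
  Ac-sym (B , autB , acB , xB , yB) = B , autB , acB , yB , xB

  Ac-trans : ∀ {x y z} → Ac T x y → Ac T y z → Ac T x z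
  Ac-trans (A , autA , acA , xA , yA) (B , autB , acB , yB , zB) =
    (A ∪ B) , ∪-autonomous T autA autB yA yB ,
    ∪-acyclic autA autB acA acB yA yB , inj₁ xA , inj₂ zB

  Ac-autonomous : ∀ x → Autonomous E (Ac T x)
  Ac-autonomous x u u' z xu xu' z∉ with Ac-trans (Ac-sym xu) xu'
  ... | B , autB , acB , uB , u'B =
    autB u u' z uB u'B (λ zB → z∉ (Ac-trans xu (B , autB , acB , uB , zB)))

  Ac-acyclic : ∀ x → Acyclic E (Ac T x)
  Ac-acyclic x a b c (A , autA , acA , xA , aA) (B , autB , acB , xB , bB)
                     (C , autC , acC , xC , cC) =
    ∪-acyclic (∪-autonomous T autA autB xA xB) autC
      (∪-acyclic autA autB acA acB xA xB) acC (inj₁ xA) xC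
      a b c (inj₁ (inj₁ aA)) (inj₁ (inj₂ bB)) (inj₂ cC)

  ≈̌⇒Ac : ∀ {a b} → _≈̌_ T a b → Ac T a b
  ≈̌⇒Ac {b = b} (_ , Acb⊆Aca) = Acb⊆Aca (Ac-refl b)

  Ac⇒≈̌ : ∀ {a b} → Ac T a b → _≈̌_ T a b
  Ac⇒≈̌ ab = Ac-trans (Ac-sym ab) , Ac-trans ab

  Ac-edge-uniform : ∀ {a b x x' y y'} → ¬ Ac T a b →
                    Ac T a x → Ac T a x' → Ac T b y → Ac T b y' → E x y → E x' y'
  Ac-edge-uniform nab ax ax' by by' xy =
    autonomous-in T (Ac-autonomous _) by by' (λ bx' → nab (Ac-trans ax' (Ac-sym bx')))
      (autonomous-out T (Ac-autonomous _) ax ax' (λ ay → nab (Ac-trans ay (Ac-sym by))) xy)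

  Ě-intro : ∀ {a b x y} → ¬ Ac T a b → Ac T a x → Ac T b y → E x y → Ě T a b
  Ě-intro nab ax by xy =
    (λ a≈b → nab (≈̌⇒Ac a≈b)) , _ , _ ,
    Ac⇒≈̌ (Ac-sym ax) , Ac⇒≈̌ (Ac-sym by) , xy

  E⇒Ě : ∀ {a b} → ¬ Ac T a b → E a b → Ě T a b
  E⇒Ě nab = Ě-intro nab (Ac-refl _) (Ac-refl _)

  Ě⇒E : ∀ {a b x y} → Ě T a b → Ac T a x → Ac T b y → E x y
  Ě⇒E (a≉b , x' , y' , x'≈a , y'≈b , x'y') ax by =
    Ac-edge-uniform (λ ab → a≉b (Ac⇒≈̌ ab))
      (Ac-sym (≈̌⇒Ac x'≈a)) ax (Ac-sym (≈̌⇒Ac y'≈b)) by x'y'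

  acyclic-components-lexSum : IsLexSum T (_≈̌_ T) (Ě T) (Ac T)
  acyclic-components-lexSum =
    (λ x → x , Ac-refl x) , (λ i j x ix jx → Ac⇒≈̌ (Ac-trans ix (Ac-sym jx))) , edges
    where
    edges : ∀ i j x y → Ac T i x → Ac T j y →
            E x y ⇔ ((_≈̌_ T i j × E x y) ⊎ (¬ _≈̌_ T i j × Ě T i j))
    edges i j x y ix jy = mk⇔ by-components from-components
      where
      by-components : E x y → (_≈̌_ T i j × E x y) ⊎ (¬ _≈̌_ T i j × Ě T i j)
      by-components xy with em {_≈̌_ T i j}
      ... | yes i≈j = inj₁ (i≈j , xy)
      ... | no i≉j  = inj₂ (i≉j , Ě-intro (λ ij → i≉j (Ac⇒≈̌ ij)) ix jy xy)
      from-components : (_≈̌_ T i j × E x y) ⊎ (¬ _≈̌_ T i j × Ě T i j) → E x y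
      from-components (inj₁ (_ , xy)) = xy
      from-components (inj₂ (_ , ij)) = Ě⇒E ij ix jy

  cycle⇒¬Ac : ∀ {a b c} → Cycle T a b c → ¬ Ac T a b
  cycle⇒¬Ac {a} {b} {c} cy@(_ , bc , ca) ab with em {Ac T a c}
  ... | yes ac = Ac-acyclic a a b c (Ac-refl a) ab ac cy
  ... | no ¬ac = E-asym T bc (autonomous-in T (Ac-autonomous a) (Ac-refl a) ab ¬ac ca)

  Ť-acyclicallyIndecomposable : AcyclicallyIndecomposable (lsuc 0ℓ) (_≈̌_ T) (Ě T)
  Ť-acyclicallyIndecomposable B B-closed autB acB x y xB yB =
    Ac⇒≈̌ (B₀ , autB₀ , acB₀ , fromWitness xB , fromWitness yB)
    where
    -- Ac only unions subsets of level 0, so B is first resized along excluded middle.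
    B₀ : Pred V 0ℓ
    B₀ z = True (em {B z})

    autB₀ : Autonomous E B₀
    autB₀ u u' z uB₀ u'B₀ z∉B₀ = mk⇔ (move (toWitness uB₀) (toWitness u'B₀))
                                      (move (toWitness u'B₀) (toWitness uB₀))
      where
      z∉B : ¬ B z
      z∉B zB = z∉B₀ (fromWitness zB)
      move : ∀ {v v'} → B v → B v' → E v z → E v' z
      move {v} {v'} vB v'B vz =
        Ě⇒E (Equivalence.to (autB v v' z vB v'B z∉B)
                            (E⇒Ě (λ vz≈ → z∉B (B-closed v z (Ac⇒≈̌ vz≈) vB)) vz))
            (Ac-refl v') (Ac-refl z)

    acB₀ : Acyclic E B₀
    acB₀ a b c aB₀ bB₀ cB₀ cy@(ab , bc , ca)
      with em {Ac T a b} | em {Ac T b c} | em {Ac T c a}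
    ... | yes Aab | _        | _        = cycle⇒¬Ac cy Aab
    ... | no _    | yes Abc  | _        = cycle⇒¬Ac (Cycle-rotate T cy) Abc
    ... | no _    | no _     | yes Aca  = cycle⇒¬Ac (Cycle-rotate T (Cycle-rotate T cy)) Aca
    ... | no ¬Aab | no ¬Abc  | no ¬Aca  =
      acB a b c (toWitness aB₀) (toWitness bB₀) (toWitness cB₀)
        (E⇒Ě ¬Aab ab , E⇒Ě ¬Abc bc , E⇒Ě ¬Aca ca)

lemma3p7 : ExcludedMiddle (lsuc 0ℓ) → (T : Tournament) →
    AcyclicallyIndecomposable (lsuc 0ℓ) (_≈̌_ T) (Ě T)
    × IsLexSum T (_≈̌_ T) (Ě T) (Ac T)
lemma3p7 em T = Ť-acyclicallyIndecomposable em T , acyclic-components-lexSum em T
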